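{- Let $(W,S)$ be a finite Coxeter system that is cube-like with respect to $J\subseteq S$ and $(W',S')$ a finite Coxeter system that is cube-like with respect to $J'\subseteq S'$. Then the product Coxeter system $(W\times W',\,S\times\{e'\}\cup\{e\}\times S')$ is cube-like (with respect to $J\times\{e'\}\cup\{e\}\times J'$). Moreover, $\iota_0(G(W^J)\,\square\, G(W'^{J'}))\ge \iota_0(G(W^J))\,\iota_0(G(W'^{J'}))$.
   Context: A finite Coxeter system $(W,S)$: $W$ finite with presentation $\langle S\mid s^2=1,\ (st)^{m_{st}}=1\rangle$, $m_{st}\ge2$ for $s\ne t$. The length $\ell(w)$ is the word length of $w$ with respect to $S$; $e,e'$ are identities. For $J\subseteq S$, $W_J=\langle J\rangle$, $W^J=\{w\in W\mid \ell(wj)>\ell(w)\ \forall j\in J\}$, and $G(W^J)$ is the graph on $W^J$ with $w\sim w'$ iff $w'=sw$ for some $s\in S$. For a graph $H$, $\iota_0(H)=\max\{|A|-|B|\mid V(H)=A\sqcup B,\ A,B\text{ independent}\}$. $(W,S)$ is cube-like with respect to $J$ if $W_J$ is abelian and $\iota_0(G(W^J))>0$; it is cube-like if it is so with respect to some $J$. $\square$ denotes the Cartesian product of graphs: $(u,u')\sim(v,v')$ iff ($u=v$ and $u'\sim v'$) or ($u'=v'$ and $u\sim v$). -}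

module Defs where

open import Level using (0ℓ)
open import Data.Nat using (ℕ; zero; suc; _≤_; _<_)
open import Data.Integer using (ℤ; +_; _-_) renaming (_≤_ to _≤ℤ_)
open import Data.Fin using (Fin)
open import Data.Bool using (Bool; true; false)
open import Data.List using (List; []; _∷_; length)
open import Data.Product using (Σ; ∃; ∃₂; _×_; _,_)
open import Data.Sum using (_⊎_; inj₁; inj₂)
open import Data.Unit using (⊤)
open import Relation.Binary.PropositionalEquality using (_≡_; _≢_)
open import Algebra.Bundles using (Group)
open import Algebra.Structures using (IsGroup)
open import Function.Definitions using (Injective)

HasCard : {A : Set} → (A → Set) → ℕ → Set
HasCard {A} P n =
  Σ (Fin n → A) λ f →
    Injective _≡_ _≡_ f × (∀ i → P (f i)) × (∀ a → P a → ∃ λ i → f i ≡ a)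

-- A group (with propositional equality) together with an indexed family
-- of generators S = { gen i | i : I }.  The group axioms etc. are in the
-- predicate IsFiniteCoxeterSystem below.

record GenGroup : Set₁ where
  field
    W    : Set
    _∙_  : W → W → W
    e    : W
    _⁻¹  : W → W
    I    : Set
    gen  : I → W

powG : (H : Group 0ℓ 0ℓ) → Group.Carrier H → ℕ → Group.Carrier H
powG H x zero    = Group.ε H
powG H x (suc n) = Group._∙_ H x (powG H x n)

module _ (G : GenGroup) where
  open GenGroup G

  powW : W → ℕ → W
  powW x zero    = e
  powW x (suc n) = x ∙ powW x n

  eval : List I → W
  eval []       = e
  eval (i ∷ ws) = gen i ∙ eval ws

  Len : W → ℕ → Set
  Len w n = (∃ λ ws → length ws ≡ n × eval ws ≡ w)
          × (∀ ws → eval ws ≡ w → n ≤ length ws)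

  data InWJ (J : I → Set) : W → Set where
    wj-e   : InWJ J e
    wj-gen : ∀ j → J j → InWJ J (gen j)
    wj-mul : ∀ {x y} → InWJ J x → InWJ J y → InWJ J (x ∙ y)
    wj-inv : ∀ {x} → InWJ J x → InWJ J (x ⁻¹)

  WJAbelian : (I → Set) → Set
  WJAbelian J = ∀ x y → InWJ J x → InWJ J y → x ∙ y ≡ y ∙ x

  InWJmin : (I → Set) → W → Set
  InWJmin J w = ∀ j → J j → ∀ n m → Len w n → Len (w ∙ gen j) m → n < m

  -- (W,S) is a finite Coxeter system: W is a finite group, gen is injective
  -- (so S is a set indexed by I), S generates W, and W has the presentation
  -- ⟨ S | s² = 1, (st)^{m_st} = 1 ⟩ (universal property w.r.t. all groups).
  record IsFiniteCoxeterSystem : Set₁ where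
    field
      isGroup   : IsGroup _≡_ _∙_ e _⁻¹
      finite    : ∃ λ n → HasCard {W} (λ _ → ⊤) n
      gen-inj   : Injective _≡_ _≡_ gen
      m         : I → I → ℕ
      m-diag    : ∀ i → m i i ≡ 1
      m-sym     : ∀ i j → m i j ≡ m j i
      m-off     : ∀ i j → i ≢ j → 2 ≤ m i j
      relations : ∀ i j → powW (gen i ∙ gen j) (m i j) ≡ e
      generates : ∀ w → ∃ λ ws → eval ws ≡ w
      universal : (H : Group 0ℓ 0ℓ) (f : I → Group.Carrier H) →
                  (∀ i j → Group._≈_ H (powG H (Group._∙_ H (f i) (f j)) (m i j)) (Group.ε H)) →
                  Σ (W → Group.Carrier H) λ φ →
                    (∀ x y → Group._≈_ H (φ (x ∙ y)) (Group._∙_ H (φ x) (φ y)))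
                    × (∀ i → Group._≈_ H (φ (gen i)) (f i))

record Graph : Set₁ where
  field
    V    : Set
    Vert : V → Set
    Adj  : V → V → Set

module _ (H : Graph) where
  open Graph H

  -- a 2-colouring c : V → Bool such that A = c⁻¹(true), B = c⁻¹(false)
  -- (restricted to vertices) are independent
  ProperColouring : (V → Bool) → Set
  ProperColouring c = ∀ u v → Vert u → Vert v → Adj u v → c u ≢ c v

  Achieves : ℤ → Set
  Achieves k = ∃ λ (c : V → Bool) → ProperColouring c ×
                 ∃₂ λ a b → HasCard (λ v → Vert v × c v ≡ true) a
                           × HasCard (λ v → Vert v × c v ≡ false) b
                           × k ≡ + a - + b

  Iota0 : ℤ → Set
  Iota0 k = Achieves k × (∀ k′ → Achieves k′ → k′ ≤ℤ k)

_□_ : Graph → Graph → Graph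
H □ H′ = record
  { V    = Graph.V H × Graph.V H′
  ; Vert = λ { (u , u′) → Graph.Vert H u × Graph.Vert H′ u′ }
  ; Adj  = λ { (u , u′) (v , v′) →
               (u ≡ v × Graph.Adj H′ u′ v′) ⊎ (u′ ≡ v′ × Graph.Adj H u v) }
  }

GW : (G : GenGroup) → (GenGroup.I G → Set) → Graph
GW G J = record
  { V    = GenGroup.W G
  ; Vert = InWJmin G J
  ; Adj  = λ w w′ → ∃ λ i → w′ ≡ GenGroup._∙_ G (GenGroup.gen G i) w
  }

CubeLikeWrt : (G : GenGroup) → (GenGroup.I G → Set) → Set
CubeLikeWrt G J = WJAbelian G J × (∃ λ k → Iota0 (GW G J) k × + 0 Data.Integer.< k)

_⊗_ : GenGroup → GenGroup → GenGroup
G ⊗ G′ = record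
  { W   = W × W′
  ; _∙_ = λ { (x , x′) (y , y′) → (x ∙ y , x′ ∙′ y′) }
  ; e   = (e , e′)
  ; _⁻¹ = λ { (x , x′) → (x ⁻¹ , x′ ⁻¹′) }
  ; I   = I ⊎ I′
  ; gen = λ { (inj₁ i) → (gen i , e′) ; (inj₂ i′) → (e , gen′ i′) }
  }
  where
  open GenGroup G
  open GenGroup G′ renaming (W to W′; _∙_ to _∙′_; e to e′; _⁻¹ to _⁻¹′; I to I′; gen to gen′)

_⊕_ : {I I′ : Set} → (I → Set) → (I′ → Set) → (I ⊎ I′ → Set)
(J ⊕ J′) (inj₁ i) = J i
(J ⊕ J′) (inj₂ i) = J′ i

module Submission where

open import Defs
open import Level using (0ℓ)
open import Data.Nat as ℕ using (ℕ; zero; suc; s≤s; z≤n)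
import Data.Nat.Properties as ℕP
open import Data.Integer as ℤ using (ℤ; +_; +<+; _*_; _≤_; _<_)
import Data.Integer.Properties as ℤP
open import Data.Fin using (Fin; zero; suc; combine; remQuot; splitAt; join; _↑ˡ_; _↑ʳ_)
import Data.Fin.Properties as FinP
open import Data.Bool using (Bool; true; false; not; _xor_)
import Data.Bool.Properties as BoolP
open import Data.Vec using (Vec; []; _∷_; lookup; tabulate)
open import Data.Vec.Properties using (lookup∘tabulate)
open import Data.List using (List; []; _∷_; _++_; length; map)
open import Data.List.Relation.Unary.Any using (here; there)
open import Data.List.Relation.Unary.All as All using (All)
open import Data.List.Relation.Unary.All.Properties using (¬Any⇒All¬; All¬⇒¬Any)
open import Data.List.Relation.Unary.Unique.Propositional using (Unique; []; _∷_)
open import Data.List.Membership.Propositional using (_∈_; _∉_)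
open import Data.Product using (Σ; ∃; _×_; _,_; proj₁; proj₂)
open import Data.Sum using (_⊎_; inj₁; inj₂)
open import Data.Unit using (⊤; tt)
open import Data.Empty using (⊥; ⊥-elim)
open import Function using (_∘_)
open import Function.Bundles using (_⇔_; mk⇔; Equivalence)
import Function.Properties.Equivalence as ⇔
open import Function.Definitions using (Injective)
open import Relation.Nullary using (¬_; Dec; yes; no; does; ¬?)
open import Relation.Nullary.Decidable using (_×-dec_; _⊎-dec_; _→-dec_; map′; does-⇔; dec-true; dec-false)
open import Relation.Unary using (Decidable)
open import Relation.Binary.Definitions using (DecidableEquality)
open import Relation.Binary.PropositionalEquality
open import Algebra.Bundles using (Group)
open import Algebra.Structures using (IsGroup)

-- If c and c′ are proper 2-colourings of H and H′ with colour classes A, B and A′, B′, then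
-- (u , u′) ↦ [c u = c′ u′] is a proper 2-colouring of H □ H′ with classes A × A′ ∪ B × B′ and
-- A × B′ ∪ B × A′, whose imbalance is (|A| − |B|)(|A′| − |B′|); hence ι₀(H □ H′) ≥ ι₀(H) ι₀(H′).
-- In the product Coxeter system ℓ(w , w′) = ℓ(w) + ℓ(w′), so (W × W′)^(J × J′) = W^J × W′^J′ and
-- G((W × W′)^(J × J′)) is exactly G(W^J) □ G(W′^J′), while W_J × W′_J′ stays abelian.
--
-- Constructively, the maximum defining ι₀(G(W^J) □ G(W′^J′)) exists only once adjacency, i.e.
-- membership in S, is decidable. This is decided with the action of W on W × {±1} that proves the
-- exchange condition: a word whose reflections are pairwise distinct (every element has one, by
-- deleting pairs of letters) represents a generator exactly when it has length one.

-- Finite cardinalities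

Enumeration : Set → ℕ → Set
Enumeration A n = HasCard {A} (λ _ → ⊤) n

module Enumeration {A : Set} {n : ℕ} (E : Enumeration A n) where

  enum : Fin n → A
  enum = proj₁ E

  index : A → Fin n
  index a = proj₁ (proj₂ (proj₂ (proj₂ E)) a tt)

  enum-index : ∀ a → enum (index a) ≡ a
  enum-index a = proj₂ (proj₂ (proj₂ (proj₂ E)) a tt)

  _≟_ : DecidableEquality A
  a ≟ b = map′ (λ eq → trans (sym (enum-index a)) (trans (cong enum eq) (enum-index b)))
               (cong index) (index a FinP.≟ index b)

HasCard-cong : ∀ {A : Set} {P Q : A → Set} {n} →
               (∀ a → P a → Q a) → (∀ a → Q a → P a) → HasCard P n → HasCard Q n
HasCard-cong P⇒Q Q⇒P (f , f-inj , fP , f-onto) =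
  f , f-inj , (λ i → P⇒Q _ (fP i)) , λ a q → f-onto a (Q⇒P a q)

HasCard-≤ : ∀ {A : Set} {P : A → Set} {m n} → HasCard P m → HasCard P n → m ℕ.≤ n
HasCard-≤ (f , f-inj , fP , _) (g , _ , _ , g-onto) = FinP.injective⇒≤ {f = h} h-inj
  where
  h : Fin _ → Fin _
  h i = proj₁ (g-onto (f i) (fP i))
  h-inj : Injective _≡_ _≡_ h
  h-inj {i} {j} eq = f-inj (trans (sym (proj₂ (g-onto (f i) (fP i))))
                             (trans (cong g eq) (proj₂ (g-onto (f j) (fP j)))))

HasCard-unique : ∀ {A : Set} {P : A → Set} {m n} → HasCard P m → HasCard P n → m ≡ n
HasCard-unique Hm Hn = ℕP.≤-antisym (HasCard-≤ Hm Hn) (HasCard-≤ Hn Hm)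

HasCard-⊥ : ∀ {A : Set} {P : A → Set} → (∀ a → ¬ P a) → HasCard P 0
HasCard-⊥ ¬P = (λ ()) , (λ { {()} }) , (λ ()) , λ a p → ⊥-elim (¬P a p)

HasCard-≡ : ∀ {A : Set} (a : A) → HasCard (a ≡_) 1
HasCard-≡ a = (λ _ → a) , (λ { {zero} {zero} _ → refl }) , (λ _ → refl) , λ _ a≡b → zero , a≡b

HasCard-⊎ : ∀ {A : Set} {P Q : A → Set} {m n} → (∀ a → P a → ¬ Q a) →
            HasCard P m → HasCard Q n → HasCard (λ a → P a ⊎ Q a) (m ℕ.+ n)
HasCard-⊎ {A} {P} {Q} {m} {n} disjoint (f , f-inj , fP , f-onto) (g , g-inj , gQ , g-onto) =
  h ∘ splitAt m , h-inj , hPQ ∘ splitAt m , onto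
  where
  h : Fin m ⊎ Fin n → A
  h (inj₁ i) = f i
  h (inj₂ j) = g j
  h-inj′ : ∀ {u v} → h u ≡ h v → u ≡ v
  h-inj′ {inj₁ i} {inj₁ j} eq = cong inj₁ (f-inj eq)
  h-inj′ {inj₁ i} {inj₂ j} eq = ⊥-elim (disjoint _ (fP i) (subst Q (sym eq) (gQ j)))
  h-inj′ {inj₂ i} {inj₁ j} eq = ⊥-elim (disjoint _ (fP j) (subst Q eq (gQ i)))
  h-inj′ {inj₂ i} {inj₂ j} eq = cong inj₂ (g-inj eq)
  h-inj : Injective _≡_ _≡_ (h ∘ splitAt m)
  h-inj {k} {l} eq = trans (sym (FinP.join-splitAt m n k))
    (trans (cong (join m n) (h-inj′ {splitAt m k} {splitAt m l} eq)) (FinP.join-splitAt m n l))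
  hPQ : ∀ u → P (h u) ⊎ Q (h u)
  hPQ (inj₁ i) = inj₁ (fP i)
  hPQ (inj₂ j) = inj₂ (gQ j)
  onto : ∀ a → P a ⊎ Q a → ∃ λ k → h (splitAt m k) ≡ a
  onto a (inj₁ p) with f-onto a p
  ... | i , fi≡a = i ↑ˡ n , trans (cong h (FinP.splitAt-↑ˡ m i n)) fi≡a
  onto a (inj₂ q) with g-onto a q
  ... | j , gj≡a = m ↑ʳ j , trans (cong h (FinP.splitAt-↑ʳ m n j)) gj≡a

HasCard-× : ∀ {A B : Set} {P : A → Set} {Q : B → Set} {m n} → HasCard P m → HasCard Q n →
            HasCard (λ (ab : A × B) → P (proj₁ ab) × Q (proj₂ ab)) (m ℕ.* n)
HasCard-× {A} {B} {P} {Q} {m} {n} (f , f-inj , fP , f-onto) (g , g-inj , gQ , g-onto) =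
  h , h-inj , (λ k → fP _ , gQ _) , onto
  where
  h : Fin (m ℕ.* n) → A × B
  h k = f (proj₁ (remQuot {m} n k)) , g (proj₂ (remQuot {m} n k))
  h-inj : Injective _≡_ _≡_ h
  h-inj {k} {l} eq = trans (sym (FinP.combine-remQuot {m} n k))
    (trans (cong₂ combine (f-inj (cong proj₁ eq)) (g-inj (cong proj₂ eq))) (FinP.combine-remQuot {m} n l))
  onto : ∀ ab → P (proj₁ ab) × Q (proj₂ ab) → ∃ λ k → h k ≡ ab
  onto (a , b) (p , q) with f-onto a p | g-onto b q
  ... | i , fi≡a | j , gj≡b = combine i j ,
    trans (cong (λ ij → f (proj₁ ij) , g (proj₂ ij)) (FinP.remQuot-combine {m} {n} i j)) (cong₂ _,_ fi≡a gj≡b)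

count-image : ∀ {A : Set} {Q : A → Set} → Decidable Q → ∀ {N} (f : Fin N → A) → Injective _≡_ _≡_ f →
              ∃ λ k → HasCard (λ a → Q a × ∃ λ i → f i ≡ a) k
count-image Q? {zero} f _ = 0 , HasCard-⊥ λ { a (_ , () , _) }
count-image {Q = Q} Q? {suc N} f f-inj with count-image Q? (f ∘ suc) (FinP.suc-injective ∘ f-inj) | Q? (f zero)
... | k , H | no ¬q = k , HasCard-cong (λ { a (q , i , fi≡a) → q , suc i , fi≡a }) from-f H
  where
  from-f : ∀ a → Q a × ∃ (λ i → f i ≡ a) → Q a × ∃ λ i → f (suc i) ≡ a
  from-f a (q , zero , refl) = ⊥-elim (¬q q)
  from-f a (q , suc i , fi≡a) = q , i , fi≡a
... | k , H | yes q = suc k , HasCard-cong to-f from-f (HasCard-⊎ f0-fresh (HasCard-≡ (f zero)) H)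
  where
  f0-fresh : ∀ a → f zero ≡ a → ¬ (Q a × ∃ λ i → f (suc i) ≡ a)
  f0-fresh a f0≡a (_ , i , fi≡a) with f-inj (trans f0≡a (sym fi≡a))
  ... | ()
  to-f : ∀ a → f zero ≡ a ⊎ (Q a × ∃ λ i → f (suc i) ≡ a) → Q a × ∃ λ i → f i ≡ a
  to-f a (inj₁ refl) = q , zero , refl
  to-f a (inj₂ (qa , i , fi≡a)) = qa , suc i , fi≡a
  from-f : ∀ a → Q a × ∃ (λ i → f i ≡ a) → f zero ≡ a ⊎ (Q a × ∃ λ i → f (suc i) ≡ a)
  from-f a (_ , zero , f0≡a) = inj₁ f0≡a
  from-f a (qa , suc i , fi≡a) = inj₂ (qa , i , fi≡a)

count : ∀ {A : Set} {n} → Enumeration A n → {Q : A → Set} → Decidable Q → ∃ λ k → HasCard Q k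
count E Q? with count-image Q? (Enumeration.enum E) (proj₁ (proj₂ E))
... | k , H = k , HasCard-cong (λ _ → proj₁) (λ a q → q , Enumeration.index E a , Enumeration.enum-index E a) H

maximise : ∀ N (P : Vec Bool N → Set) → Decidable P → (val : Vec Bool N → ℤ) →
           (∀ v → ¬ P v) ⊎ (∃ λ v → P v × ∀ v′ → P v′ → val v′ ≤ val v)
maximise zero P P? val with P? []
... | yes p = inj₂ ([] , p , λ { [] _ → ℤP.≤-refl })
... | no ¬p = inj₁ λ { [] → ¬p }
maximise (suc N) P P? val
  with maximise N (P ∘ (false ∷_)) (P? ∘ (false ∷_)) (val ∘ (false ∷_))
     | maximise N (P ∘ (true ∷_)) (P? ∘ (true ∷_)) (val ∘ (true ∷_))
... | inj₁ ¬P₀ | inj₁ ¬P₁ = inj₁ λ { (false ∷ v) → ¬P₀ v ; (true ∷ v) → ¬P₁ v }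
... | inj₁ ¬P₀ | inj₂ (v₁ , p₁ , max₁) =
  inj₂ (true ∷ v₁ , p₁ , λ { (false ∷ v) p → ⊥-elim (¬P₀ v p) ; (true ∷ v) p → max₁ v p })
... | inj₂ (v₀ , p₀ , max₀) | inj₁ ¬P₁ =
  inj₂ (false ∷ v₀ , p₀ , λ { (false ∷ v) p → max₀ v p ; (true ∷ v) p → ⊥-elim (¬P₁ v p) })
... | inj₂ (v₀ , p₀ , max₀) | inj₂ (v₁ , p₁ , max₁) with ℤP.≤-total (val (false ∷ v₀)) (val (true ∷ v₁))
...   | inj₁ le = inj₂ (true ∷ v₁ , p₁ , λ { (false ∷ v) p → ℤP.≤-trans (max₀ v p) le ; (true ∷ v) p → max₁ v p })
...   | inj₂ le = inj₂ (false ∷ v₀ , p₀ , λ { (false ∷ v) p → max₀ v p ; (true ∷ v) p → ℤP.≤-trans (max₁ v p) le })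

-- ι₀ of a Cartesian product

ColourClass : (H : Graph) → (Graph.V H → Bool) → Bool → Graph.V H → Set
ColourClass H c β v = Graph.Vert H v × c v ≡ β

module _ (H : Graph) where
  open Graph H

  Achieves⇒Vert-dec : DecidableEquality V → ∀ {k} → Achieves H k → Decidable Vert
  Achieves⇒Vert-dec _≟_ (c , _ , _ , _ , (f , _ , fP , f-onto) , (g , _ , gP , g-onto) , _) v with c v in cv
  ... | true  = map′ (λ (i , fi≡v) → subst Vert fi≡v (proj₁ (fP i))) (λ vv → f-onto v (vv , cv))
                     (FinP.any? λ i → f i ≟ v)
  ... | false = map′ (λ (i , gi≡v) → subst Vert gi≡v (proj₁ (gP i))) (λ vv → g-onto v (vv , cv))
                     (FinP.any? λ i → g i ≟ v)

  Iota0-exists : ∀ {N} → Enumeration V N → (∀ u v → Dec (Adj u v)) → ∀ {k} → Achieves H k → ∃ (Iota0 H)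
  Iota0-exists {N} E Adj? achieves = best (maximise N (ProperColouring H ∘ colour) (proper? ∘ colour) value)
    where
    open Enumeration E
    Vert? : Decidable Vert
    Vert? = Achieves⇒Vert-dec _≟_ achieves

    colour : Vec Bool N → V → Bool
    colour v x = lookup v (index x)

    proper? : ∀ c → Dec (ProperColouring H c)
    proper? c = map′ (λ p u w vu vw adj → subst₂ (λ x y → Vert x → Vert y → Adj x y → c x ≢ c y)
                                            (enum-index u) (enum-index w) (p (index u) (index w)) vu vw adj)
                     (λ p i j → p (enum i) (enum j))
                     (FinP.all? λ i → FinP.all? λ j →
                        Vert? _ →-dec Vert? _ →-dec Adj? _ _ →-dec ¬? (c (enum i) BoolP.≟ c (enum j)))

    colourClass : (v : Vec Bool N) (β : Bool) → ∃ λ a → HasCard (ColourClass H (colour v) β) a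
    colourClass v β = count E (λ x → Vert? x ×-dec (colour v x BoolP.≟ β))

    value : Vec Bool N → ℤ
    value v = + proj₁ (colourClass v true) ℤ.- + proj₁ (colourClass v false)

    achieved : ∀ v → ProperColouring H (colour v) → Achieves H (value v)
    achieved v p = colour v , p , _ , _ , proj₂ (colourClass v true) , proj₂ (colourClass v false) , refl

    asVector : ∀ {k} → Achieves H k → ∃ λ v → ProperColouring H (colour v) × k ≡ value v
    asVector (c , p , a , b , A , B , k≡) =
      v , (λ x y vx vy adj eq → p x y vx vy adj (trans (sym (colour-v x)) (trans eq (colour-v y)))) ,
      trans k≡ (cong₂ (λ a b → + a ℤ.- + b) (HasCard-unique (recolour A) (proj₂ (colourClass v true)))
                                           (HasCard-unique (recolour B) (proj₂ (colourClass v false))))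
      where
      v : Vec Bool N
      v = tabulate (c ∘ enum)
      colour-v : ∀ x → colour v x ≡ c x
      colour-v x = trans (lookup∘tabulate (c ∘ enum) (index x)) (cong c (enum-index x))
      recolour : ∀ {β n} → HasCard (ColourClass H c β) n → HasCard (ColourClass H (colour v) β) n
      recolour = HasCard-cong (λ x (vx , e) → vx , trans (colour-v x) e) (λ x (vx , e) → vx , trans (sym (colour-v x)) e)

    best : (∀ v → ¬ ProperColouring H (colour v)) ⊎
           (∃ λ v → ProperColouring H (colour v) × ∀ v′ → ProperColouring H (colour v′) → value v′ ≤ value v) →
           ∃ (Iota0 H)
    best (inj₁ none) = let (v , proper , _) = asVector achieves in ⊥-elim (none v proper)
    best (inj₂ (v , proper , max)) = value v , achieved v proper , λ k′ a′ →
      let (v′ , proper′ , k′≡) = asVector a′ in subst (_≤ value v) (sym k′≡) (max v′ proper′)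

module _ {V : Set} {Vert Vert′ : V → Set} {Adj Adj′ : V → V → Set} where
  private
    H H′ : Graph
    H = record { V = V ; Vert = Vert ; Adj = Adj }
    H′ = record { V = V ; Vert = Vert′ ; Adj = Adj′ }

  Achieves-⇔ : (∀ v → Vert v ⇔ Vert′ v) → (∀ u v → Adj u v ⇔ Adj′ u v) → ∀ {k} → Achieves H k → Achieves H′ k
  Achieves-⇔ Vert⇔ Adj⇔ (c , proper , a , b , A , B , k≡) =
    c , (λ u v vu vv adj → proper u v (from (Vert⇔ u) vu) (from (Vert⇔ v) vv) (from (Adj⇔ u v) adj)) ,
    a , b , transport A , transport B , k≡
    where
    open Equivalence
    transport : ∀ {β n} → HasCard (ColourClass H c β) n → HasCard (ColourClass H′ c β) n
    transport = HasCard-cong (λ v (vv , e) → to (Vert⇔ v) vv , e) (λ v (vv , e) → from (Vert⇔ v) vv , e)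

Iota0-⇔ : ∀ {V : Set} {Vert Vert′ : V → Set} {Adj Adj′ : V → V → Set} →
          (∀ v → Vert v ⇔ Vert′ v) → (∀ u v → Adj u v ⇔ Adj′ u v) → ∀ {k} →
          Iota0 (record { V = V ; Vert = Vert ; Adj = Adj }) k → Iota0 (record { V = V ; Vert = Vert′ ; Adj = Adj′ }) k
Iota0-⇔ Vert⇔ Adj⇔ (achieves , max) =
  Achieves-⇔ Vert⇔ Adj⇔ achieves ,
  λ k′ a′ → max k′ (Achieves-⇔ (λ v → ⇔.sym (Vert⇔ v)) (λ u v → ⇔.sym (Adj⇔ u v)) a′)

xnor-split : ∀ x y {β} → not (x xor y) ≡ β → (x ≡ true × y ≡ β) ⊎ (x ≡ false × y ≡ not β)
xnor-split true  y refl = inj₁ (refl , sym (BoolP.not-involutive y))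
xnor-split false y refl = inj₂ (refl , sym (BoolP.not-involutive y))

xnor-cancelˡ : ∀ x {y z} → not (x xor y) ≡ not (x xor z) → y ≡ z
xnor-cancelˡ true  eq = BoolP.not-injective (BoolP.not-injective eq)
xnor-cancelˡ false eq = BoolP.not-injective eq

module _ (H H′ : Graph) where
  open Graph H
  open Graph H′ using () renaming (V to V′; Vert to Vert′; Adj to Adj′)

  boxColouring : (V → Bool) → (V′ → Bool) → V × V′ → Bool
  boxColouring c c′ (u , u′) = not (c u xor c′ u′)

  boxColouring-proper : ∀ {c c′} → ProperColouring H c → ProperColouring H′ c′ →
                        ProperColouring (H □ H′) (boxColouring c c′)
  boxColouring-proper {c} {c′} _ proper′ (u , u′) (v , v′) (_ , vu′) (_ , vv′) (inj₁ (refl , adj′)) eq =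
    proper′ u′ v′ vu′ vv′ adj′ (xnor-cancelˡ (c u) eq)
  boxColouring-proper {c} {c′} proper _ (u , u′) (v , v′) (vu , _) (vv , _) (inj₂ (refl , adj)) eq =
    proper u v vu vv adj (xnor-cancelˡ (c′ u′) (trans (cong not (BoolP.xor-comm (c′ u′) (c u)))
                                                (trans eq (cong not (BoolP.xor-comm (c v) (c′ u′))))))

  boxColouring-class : ∀ {c c′} β {a b m n} →
    HasCard (ColourClass H c true) a → HasCard (ColourClass H c false) b →
    HasCard (ColourClass H′ c′ β) m → HasCard (ColourClass H′ c′ (not β)) n →
    HasCard (ColourClass (H □ H′) (boxColouring c c′) β) (a ℕ.* m ℕ.+ b ℕ.* n)
  boxColouring-class {c} {c′} β A B M N =
    HasCard-cong merge split
      (HasCard-⊎ (λ { _ ((_ , ct) , _) ((_ , cf) , _) → BoolP.not-¬ ct cf }) (HasCard-× A M) (HasCard-× B N))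
    where
    Split : V × V′ → Set
    Split (u , u′) = (ColourClass H c true u × ColourClass H′ c′ β u′)
                   ⊎ (ColourClass H c false u × ColourClass H′ c′ (not β) u′)
    merge : ∀ p → Split p → ColourClass (H □ H′) (boxColouring c c′) β p
    merge (u , u′) (inj₁ ((vu , cu) , (vu′ , c′u′))) =
      (vu , vu′) , trans (cong₂ (λ x y → not (x xor y)) cu c′u′) (BoolP.not-involutive β)
    merge (u , u′) (inj₂ ((vu , cu) , (vu′ , c′u′))) =
      (vu , vu′) , trans (cong₂ (λ x y → not (x xor y)) cu c′u′) (BoolP.not-involutive β)
    split : ∀ p → ColourClass (H □ H′) (boxColouring c c′) β p → Split p
    split (u , u′) ((vu , vu′) , eq) with xnor-split (c u) (c′ u′) eq
    ... | inj₁ (cu , c′u′) = inj₁ ((vu , cu) , (vu′ , c′u′))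
    ... | inj₂ (cu , c′u′) = inj₂ ((vu , cu) , (vu′ , c′u′))

  Achieves-□ : ∀ {a b} → Achieves H a → Achieves H′ b → Achieves (H □ H′) (a * b)
  Achieves-□ (c , proper , a₁ , b₁ , A , B , refl) (c′ , proper′ , a₂ , b₂ , A′ , B′ , refl) =
    boxColouring c c′ , boxColouring-proper proper proper′ , _ , _ ,
    boxColouring-class true A B A′ B′ , boxColouring-class false A B B′ A′ , product-of-differences
    where
    open import Data.Integer.Solver using (module +-*-Solver)
    open +-*-Solver
    product-of-differences : (+ a₁ ℤ.- + b₁) * (+ a₂ ℤ.- + b₂) ≡ + (a₁ ℕ.* a₂ ℕ.+ b₁ ℕ.* b₂) ℤ.- + (a₁ ℕ.* b₂ ℕ.+ b₁ ℕ.* a₂)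
    product-of-differences = begin
      (+ a₁ ℤ.- + b₁) * (+ a₂ ℤ.- + b₂)
        ≡⟨ solve 4 (λ x y z w → (x :- y) :* (z :- w) := (x :* z :+ y :* w) :- (x :* w :+ y :* z))
                 refl (+ a₁) (+ b₁) (+ a₂) (+ b₂) ⟩
      (+ a₁ * + a₂ ℤ.+ + b₁ * + b₂) ℤ.- (+ a₁ * + b₂ ℤ.+ + b₁ * + a₂)
        ≡⟨ sym (cong₂ ℤ._-_ (pos-*+* a₁ a₂ b₁ b₂) (pos-*+* a₁ b₂ b₁ a₂)) ⟩
      + (a₁ ℕ.* a₂ ℕ.+ b₁ ℕ.* b₂) ℤ.- + (a₁ ℕ.* b₂ ℕ.+ b₁ ℕ.* a₂) ∎
      where
      open ≡-Reasoning
      pos-*+* : ∀ w x y z → + (w ℕ.* x ℕ.+ y ℕ.* z) ≡ + w * + x ℤ.+ + y * + z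
      pos-*+* w x y z = trans (ℤP.pos-+ (w ℕ.* x) (y ℕ.* z)) (cong₂ ℤ._+_ (ℤP.pos-* w x) (ℤP.pos-* y z))

Enumeration-× : ∀ {A B : Set} {m n} → Enumeration A m → Enumeration B n → Enumeration (A × B) (m ℕ.* n)
Enumeration-× E E′ = HasCard-cong (λ _ _ → tt) (λ _ _ → tt , tt) (HasCard-× E E′)

Iota0-□-≥ : ∀ (H H′ : Graph) {m n} → Enumeration (Graph.V H) m → Enumeration (Graph.V H′) n →
            (∀ u v → Dec (Graph.Adj H u v)) → (∀ u v → Dec (Graph.Adj H′ u v)) →
            ∀ {a b} → Achieves H a → Achieves H′ b → ∃ λ c → Iota0 (H □ H′) c × a * b ≤ c
Iota0-□-≥ H H′ E E′ Adj? Adj′? achieves achieves′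
  with Iota0-exists (H □ H′) (Enumeration-× E E′) □-Adj? (Achieves-□ H H′ achieves achieves′)
  where
  □-Adj? : ∀ p q → Dec (Graph.Adj (H □ H′) p q)
  □-Adj? (u , u′) (v , v′) = (Enumeration._≟_ E u v ×-dec Adj′? u′ v′) ⊎-dec (Enumeration._≟_ E′ u′ v′ ×-dec Adj? u v)
... | c , iota0 = c , iota0 , proj₂ iota0 _ (Achieves-□ H H′ achieves achieves′)

-- Coxeter systems: the reflection action and membership in S

xor-cancelʳ : ∀ b x → (b xor x) xor x ≡ b
xor-cancelʳ b x = trans (BoolP.xor-assoc b x x) (trans (cong (b xor_) (BoolP.xor-same x)) (BoolP.xor-identityʳ b))

record Permutation (X : Set) : Set where
  field
    to from     : X → X
    from∘to     : ∀ x → from (to x) ≡ x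
    to∘from     : ∀ x → to (from x) ≡ x

module _ (X : Set) where
  open Permutation

  Permutations : Group 0ℓ 0ℓ
  Permutations = record
    { Carrier = Permutation X
    ; _≈_ = λ σ τ → ∀ x → to σ x ≡ to τ x
    ; _∙_ = λ σ τ → record
        { to = to σ ∘ to τ ; from = from τ ∘ from σ
        ; from∘to = λ x → trans (cong (from τ) (from∘to σ (to τ x))) (from∘to τ x)
        ; to∘from = λ x → trans (cong (to σ) (to∘from τ (from σ x))) (to∘from σ x) }
    ; ε = record { to = λ x → x ; from = λ x → x ; from∘to = λ _ → refl ; to∘from = λ _ → refl }
    ; _⁻¹ = λ σ → record { to = from σ ; from = to σ ; from∘to = to∘from σ ; to∘from = from∘to σ }
    ; isGroup = record
      { isMonoid = record
        { isSemigroup = record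
          { isMagma = record
            { isEquivalence = record { refl = λ _ → refl ; sym = λ p x → sym (p x) ; trans = λ p q x → trans (p x) (q x) }
            ; ∙-cong = λ {σ} {σ′} {τ} {τ′} σ≈σ′ τ≈τ′ x → trans (cong (to σ) (τ≈τ′ x)) (σ≈σ′ (to τ′ x)) }
          ; assoc = λ _ _ _ _ → refl }
        ; identity = (λ _ _ → refl) , (λ _ _ → refl) }
      ; inverse = from∘to , to∘from
      ; ⁻¹-cong = λ {σ} {τ} σ≈τ x → trans (cong (from σ) (sym (to∘from τ x)))
                                      (trans (cong (from σ) (sym (σ≈τ (from τ x)))) (from∘to σ (from τ x))) } }

module CoxeterSystem (G : GenGroup) (C : IsFiniteCoxeterSystem G) where
  open GenGroup G
  open IsFiniteCoxeterSystem C
  open IsGroup isGroup using (assoc; identityˡ; identityʳ; inverseˡ; inverseʳ)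

  group : Group 0ℓ 0ℓ
  group = record { Carrier = W ; _≈_ = _≡_ ; _∙_ = _∙_ ; ε = e ; _⁻¹ = _⁻¹ ; isGroup = isGroup }

  open import Algebra.Properties.Group group
    using (ε⁻¹≈ε; ⁻¹-involutive; ⁻¹-anti-homo-∙; inverseˡ-unique; inverseʳ-unique; //-rightDividesˡ; //-rightDividesʳ)
  open import Algebra.Solver.Monoid (Group.monoid group) using (solve; _⊜_) renaming (_⊕_ to _⊛_)

  _≟_ : DecidableEquality W
  _≟_ = Enumeration._≟_ (proj₂ finite)

  gen²≡e : ∀ i → gen i ∙ gen i ≡ e
  gen²≡e i = trans (sym (identityʳ _)) (subst (λ k → powW G (gen i ∙ gen i) k ≡ e) (m-diag i) (relations i i))

  gen⁻¹≡gen : ∀ i → gen i ⁻¹ ≡ gen i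
  gen⁻¹≡gen i = sym (inverseʳ-unique (gen i) (gen i) (gen²≡e i))

  powW-+ : ∀ x a b → powW G x (a ℕ.+ b) ≡ powW G x a ∙ powW G x b
  powW-+ x zero b = sym (identityˡ _)
  powW-+ x (suc a) b = trans (cong (x ∙_) (powW-+ x a b)) (sym (assoc _ _ _))

  powW-sucʳ : ∀ x n → powW G x (suc n) ≡ powW G x n ∙ x
  powW-sucʳ x zero = trans (identityʳ x) (sym (identityˡ x))
  powW-sucʳ x (suc n) = trans (cong (x ∙_) (powW-sucʳ x n)) (sym (assoc _ _ _))

  powW-≡e : ∀ {x} n → x ≡ e → powW G x n ≡ e
  powW-≡e zero _ = refl
  powW-≡e (suc n) refl = trans (cong (e ∙_) (powW-≡e n refl)) (identityˡ e)

  powW-2-gen : ∀ {x} i → x ≡ gen i → powW G x 2 ≡ e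
  powW-2-gen i refl = trans (cong (gen i ∙_) (identityʳ (gen i))) (gen²≡e i)

  conj : W → W → W
  conj c t = (c ∙ t) ∙ (c ⁻¹)

  conj-∙ : ∀ a b t → conj a (conj b t) ≡ conj (a ∙ b) t
  conj-∙ a b t = begin
      (a ∙ ((b ∙ t) ∙ (b ⁻¹))) ∙ (a ⁻¹)
    ≡⟨ solve 5 (λ a b t b⁻ a⁻ → (a ⊛ ((b ⊛ t) ⊛ b⁻)) ⊛ a⁻ ⊜ ((a ⊛ b) ⊛ t) ⊛ (b⁻ ⊛ a⁻)) refl a b t (b ⁻¹) (a ⁻¹) ⟩
      ((a ∙ b) ∙ t) ∙ ((b ⁻¹) ∙ (a ⁻¹))
    ≡⟨ cong (((a ∙ b) ∙ t) ∙_) (sym (⁻¹-anti-homo-∙ a b)) ⟩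
      ((a ∙ b) ∙ t) ∙ ((a ∙ b) ⁻¹) ∎
    where open ≡-Reasoning

  conj-e : ∀ t → conj e t ≡ t
  conj-e t = trans (cong ((e ∙ t) ∙_) ε⁻¹≈ε) (trans (identityʳ _) (identityˡ t))

  conj-cancel : ∀ c d t → c ∙ d ≡ e → conj c (conj d t) ≡ t
  conj-cancel c d t cd≡e = trans (conj-∙ c d t) (trans (cong (λ x → conj x t) cd≡e) (conj-e t))

  conj-≡-⇔ : ∀ c t y {z} → conj (c ⁻¹) y ≡ z → (conj c t ≡ y) ⇔ (t ≡ z)
  conj-≡-⇔ c t y refl = mk⇔ (λ eq → trans (sym (conj-cancel (c ⁻¹) c t (inverseˡ c))) (cong (conj (c ⁻¹)) eq))
                            (λ eq → trans (cong (conj c) eq) (conj-cancel c (c ⁻¹) y (inverseʳ c)))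

  does-conj : ∀ c t y {z} → conj (c ⁻¹) y ≡ z → does (conj c t ≟ y) ≡ does (t ≟ z)
  does-conj c t y {z} eq = does-⇔ (conj-≡-⇔ c t y eq) (conj c t ≟ y) (t ≟ z)

  conj-gen-self : ∀ i → conj (gen i ⁻¹) (gen i) ≡ gen i
  conj-gen-self i = begin
      ((gen i ⁻¹) ∙ gen i) ∙ ((gen i ⁻¹) ⁻¹) ≡⟨ cong (_∙ ((gen i ⁻¹) ⁻¹)) (inverseˡ (gen i)) ⟩
      e ∙ ((gen i ⁻¹) ⁻¹)                    ≡⟨ identityˡ _ ⟩
      (gen i ⁻¹) ⁻¹                          ≡⟨ ⁻¹-involutive (gen i) ⟩
      gen i                                  ∎
    where open ≡-Reasoning

  -- (t , b) ↦ (s t s⁻¹ , b xor [t = s]), on all of W rather than on the reflections only.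
  π : W → W × Bool → W × Bool
  π s (t , b) = conj s t , b xor does (t ≟ s)

  π-gen-involutive : ∀ i z → π (gen i) (π (gen i) z) ≡ z
  π-gen-involutive i (t , b) = cong₂ _,_
    (conj-cancel (gen i) (gen i) t (gen²≡e i))
    (trans (cong ((b xor does (t ≟ gen i)) xor_) (does-conj (gen i) t (gen i) (conj-gen-self i)))
           (xor-cancelʳ b _))

  genPermutation : I → Permutation (W × Bool)
  genPermutation i = record { to = π (gen i) ; from = π (gen i)
                            ; from∘to = π-gen-involutive i ; to∘from = π-gen-involutive i }

  private
    Perm : Set
    Perm = Permutation (W × Bool)
    open Group (Permutations (W × Bool)) using () renaming (_≈_ to _≈ₚ_; _∙_ to _∘ₚ_; ε to idₚ)
    open Permutation

  module CoxeterRelation (i j : I) where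
    g h : W
    g = gen i
    h = gen j

    p q : ℕ → W
    p = powW G (g ∙ h)
    q = powW G (h ∙ g)

    u : ℕ → W
    u k = q k ∙ h

    flips : ℕ → W → Bool
    flips zero t = false
    flips (suc n) t = (flips n t xor does (conj (p n) t ≟ h)) xor does (conj h (conj (p n) t) ≟ g)

    power-action : ∀ n t b → to (powG (Permutations (W × Bool)) (genPermutation i ∘ₚ genPermutation j) n) (t , b)
                           ≡ (conj (p n) t , b xor flips n t)
    power-action zero t b = cong₂ _,_ (sym (conj-e t)) (sym (BoolP.xor-identityʳ b))
    power-action (suc n) t b = trans (cong (π g ∘ π h) (power-action n t b)) (cong₂ _,_
      (trans (conj-∙ g h _) (conj-∙ (g ∙ h) (p n) t))
      (trans (BoolP.xor-assoc (b xor flips n t) _ _) (trans (BoolP.xor-assoc b (flips n t) _)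
        (cong (b xor_) (sym (BoolP.xor-assoc (flips n t) _ _))))))

    h∙p≡q∙h : ∀ n → h ∙ p n ≡ q n ∙ h
    h∙p≡q∙h zero = trans (identityʳ h) (sym (identityˡ h))
    h∙p≡q∙h (suc n) = begin
        h ∙ ((g ∙ h) ∙ p n)
      ≡⟨ solve 4 (λ h g h′ P → h ⊛ ((g ⊛ h′) ⊛ P) ⊜ (h ⊛ g) ⊛ (h′ ⊛ P)) refl h g h (p n) ⟩
        (h ∙ g) ∙ (h ∙ p n)
      ≡⟨ cong ((h ∙ g) ∙_) (h∙p≡q∙h n) ⟩
        (h ∙ g) ∙ (q n ∙ h)
      ≡⟨ sym (assoc _ _ _) ⟩
        ((h ∙ g) ∙ q n) ∙ h ∎
      where open ≡-Reasoning

    p∙q≡e : ∀ n → p n ∙ q n ≡ e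
    p∙q≡e zero = identityˡ e
    p∙q≡e (suc n) = begin
        p (suc n) ∙ q (suc n)
      ≡⟨ cong (_∙ q (suc n)) (powW-sucʳ (g ∙ h) n) ⟩
        (p n ∙ (g ∙ h)) ∙ ((h ∙ g) ∙ q n)
      ≡⟨ solve 6 (λ P g h h′ g′ Q → (P ⊛ (g ⊛ h)) ⊛ ((h′ ⊛ g′) ⊛ Q) ⊜ P ⊛ ((g ⊛ ((h ⊛ h′) ⊛ g′)) ⊛ Q))
               refl (p n) g h h g (q n) ⟩
        p n ∙ ((g ∙ ((h ∙ h) ∙ g)) ∙ q n)
      ≡⟨ cong (λ y → p n ∙ ((g ∙ (y ∙ g)) ∙ q n)) (gen²≡e j) ⟩
        p n ∙ ((g ∙ (e ∙ g)) ∙ q n)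
      ≡⟨ cong (λ y → p n ∙ ((g ∙ y) ∙ q n)) (identityˡ g) ⟩
        p n ∙ ((g ∙ g) ∙ q n)
      ≡⟨ cong (λ y → p n ∙ (y ∙ q n)) (gen²≡e i) ⟩
        p n ∙ (e ∙ q n)
      ≡⟨ cong (p n ∙_) (identityˡ (q n)) ⟩
        p n ∙ q n
      ≡⟨ p∙q≡e n ⟩
        e ∎
      where open ≡-Reasoning

    p⁻¹≡q : ∀ n → p n ⁻¹ ≡ q n
    p⁻¹≡q n = sym (inverseʳ-unique (p n) (q n) (p∙q≡e n))

    q⁻¹≡p : ∀ n → q n ⁻¹ ≡ p n
    q⁻¹≡p n = sym (inverseˡ-unique (p n) (q n) (p∙q≡e n))

    does-first-flip : ∀ n t → does (conj (p n) t ≟ h) ≡ does (t ≟ u (n ℕ.+ n))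
    does-first-flip n t = does-conj (p n) t h (begin
        ((p n ⁻¹) ∙ h) ∙ ((p n ⁻¹) ⁻¹) ≡⟨ cong₂ (λ a b → (a ∙ h) ∙ b) (p⁻¹≡q n) (trans (cong _⁻¹ (p⁻¹≡q n)) (q⁻¹≡p n)) ⟩
        (q n ∙ h) ∙ p n                ≡⟨ assoc _ _ _ ⟩
        q n ∙ (h ∙ p n)                ≡⟨ cong (q n ∙_) (h∙p≡q∙h n) ⟩
        q n ∙ (q n ∙ h)                ≡⟨ sym (assoc _ _ _) ⟩
        (q n ∙ q n) ∙ h                ≡⟨ cong (_∙ h) (sym (powW-+ (h ∙ g) n n)) ⟩
        u (n ℕ.+ n)                    ∎)
      where open ≡-Reasoning

    does-second-flip : ∀ n t → does (conj h (conj (p n) t) ≟ g) ≡ does (t ≟ u (n ℕ.+ suc n))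
    does-second-flip n t = trans (cong (λ y → does (y ≟ g)) (conj-∙ h (p n) t)) (does-conj (h ∙ p n) t g (begin
        (((h ∙ p n) ⁻¹) ∙ g) ∙ (((h ∙ p n) ⁻¹) ⁻¹) ≡⟨ cong₂ (λ a b → (a ∙ g) ∙ b) h∙p⁻¹ (⁻¹-involutive (h ∙ p n)) ⟩
        ((q n ∙ h) ∙ g) ∙ (h ∙ p n)                 ≡⟨ cong (((q n ∙ h) ∙ g) ∙_) (h∙p≡q∙h n) ⟩
        ((q n ∙ h) ∙ g) ∙ (q n ∙ h)
          ≡⟨ solve 5 (λ Q h g Q′ h′ → ((Q ⊛ h) ⊛ g) ⊛ (Q′ ⊛ h′) ⊜ (Q ⊛ ((h ⊛ g) ⊛ Q′)) ⊛ h′) refl (q n) h g (q n) h ⟩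
        (q n ∙ q (suc n)) ∙ h                       ≡⟨ cong (_∙ h) (sym (powW-+ (h ∙ g) n (suc n))) ⟩
        u (n ℕ.+ suc n)                             ∎))
      where
      open ≡-Reasoning
      h∙p⁻¹ : (h ∙ p n) ⁻¹ ≡ q n ∙ h
      h∙p⁻¹ = trans (⁻¹-anti-homo-∙ h (p n)) (cong₂ _∙_ (p⁻¹≡q n) (gen⁻¹≡gen j))

    -- With u k = (hg)ᵏ h, (π g ∘ π h)ⁿ flips the bit at t once for each k < 2n with t = u k;
    -- when (gh)ᴹ = e the sequence u has period M, so over 2M steps every flip occurs twice.
    window : ℕ → ℕ → W → Bool
    window s zero t = false
    window s (suc L) t = does (t ≟ u s) xor window (suc s) L t

    window-+ : ∀ s a b t → window s (a ℕ.+ b) t ≡ window s a t xor window (s ℕ.+ a) b t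
    window-+ s zero b t = cong (λ k → window k b t) (sym (ℕP.+-identityʳ s))
    window-+ s (suc a) b t = trans (cong (does (t ≟ u s) xor_)
        (trans (window-+ (suc s) a b t) (cong (λ k → window (suc s) a t xor window k b t) (sym (ℕP.+-suc s a)))))
      (sym (BoolP.xor-assoc (does (t ≟ u s)) (window (suc s) a t) (window (s ℕ.+ suc a) b t)))

    flips≡window : ∀ n t → flips n t ≡ window 0 (n ℕ.+ n) t
    flips≡window zero t = refl
    flips≡window (suc n) t = begin
        (flips n t xor does (conj (p n) t ≟ h)) xor does (conj h (conj (p n) t) ≟ g)
      ≡⟨ cong₂ (λ a b → (a xor b) xor does (conj h (conj (p n) t) ≟ g)) (flips≡window n t) (does-first-flip n t) ⟩
        (W₀ xor does (t ≟ u (n ℕ.+ n))) xor does (conj h (conj (p n) t) ≟ g)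
      ≡⟨ cong ((W₀ xor does (t ≟ u (n ℕ.+ n))) xor_) (does-second-flip n t) ⟩
        (W₀ xor does (t ≟ u (n ℕ.+ n))) xor does (t ≟ u (n ℕ.+ suc n))
      ≡⟨ BoolP.xor-assoc W₀ _ _ ⟩
        W₀ xor (does (t ≟ u (n ℕ.+ n)) xor does (t ≟ u (n ℕ.+ suc n)))
      ≡⟨ cong (λ y → W₀ xor (does (t ≟ u (n ℕ.+ n)) xor y))
              (trans (cong (λ k → does (t ≟ u k)) (ℕP.+-suc n n)) (sym (BoolP.xor-identityʳ _))) ⟩
        W₀ xor window (n ℕ.+ n) 2 t
      ≡⟨ sym (window-+ 0 (n ℕ.+ n) 2 t) ⟩
        window 0 ((n ℕ.+ n) ℕ.+ 2) t
      ≡⟨ cong (λ k → window 0 k t) (trans (ℕP.+-comm (n ℕ.+ n) 2) (cong suc (sym (ℕP.+-suc n n)))) ⟩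
        window 0 (suc n ℕ.+ suc n) t ∎
      where
      open ≡-Reasoning
      W₀ : Bool
      W₀ = window 0 (n ℕ.+ n) t

    module _ {M : ℕ} (p-M≡e : p M ≡ e) where
      u-periodic : ∀ s → u (s ℕ.+ M) ≡ u s
      u-periodic s = cong (_∙ h) (trans (powW-+ (h ∙ g) s M) (trans (cong (q s ∙_) q-M≡e) (identityʳ _)))
        where
        q-M≡e : q M ≡ e
        q-M≡e = trans (sym (identityˡ (q M))) (trans (cong (_∙ q M) (sym p-M≡e)) (p∙q≡e M))

      window-periodic : ∀ L s t → window (s ℕ.+ M) L t ≡ window s L t
      window-periodic zero s t = refl
      window-periodic (suc L) s t = cong₂ _xor_ (cong (λ y → does (t ≟ y)) (u-periodic s)) (window-periodic L (suc s) t)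

      flips-vanish : ∀ t → flips M t ≡ false
      flips-vanish t = begin
        flips M t                                ≡⟨ flips≡window M t ⟩
        window 0 (M ℕ.+ M) t                     ≡⟨ window-+ 0 M M t ⟩
        window 0 M t xor window M M t            ≡⟨ cong (window 0 M t xor_) (window-periodic M 0 t) ⟩
        window 0 M t xor window 0 M t            ≡⟨ BoolP.xor-same (window 0 M t) ⟩
        false                                    ∎
        where open ≡-Reasoning

      relation : powG (Permutations (W × Bool)) (genPermutation i ∘ₚ genPermutation j) M ≈ₚ idₚ
      relation (t , b) = trans (power-action M t b) (cong₂ _,_
        (trans (cong (λ y → conj y t) p-M≡e) (conj-e t))
        (trans (cong (b xor_) (flips-vanish t)) (BoolP.xor-identityʳ b)))

  representation : Σ (W → Perm) λ ρ → (∀ x y → ρ (x ∙ y) ≈ₚ (ρ x ∘ₚ ρ y)) × (∀ i → ρ (gen i) ≈ₚ genPermutation i)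
  representation = universal (Permutations (W × Bool)) genPermutation
                             (λ i j → CoxeterRelation.relation i j {m i j} (relations i j))

  ρ : W → Perm
  ρ = proj₁ representation

  ρ-∙ : ∀ x y → ρ (x ∙ y) ≈ₚ (ρ x ∘ₚ ρ y)
  ρ-∙ = proj₁ (proj₂ representation)

  ρ-gen : ∀ i → ρ (gen i) ≈ₚ genPermutation i
  ρ-gen = proj₂ (proj₂ representation)

  ρ-e : ρ e ≈ₚ idₚ
  ρ-e = identityˡ-unique (ρ e) (ρ e) (λ z → sym (trans (cong (λ x → to (ρ x) z) (sym (identityˡ e))) (ρ-∙ e e z)))
    where open import Algebra.Properties.Group (Permutations (W × Bool)) using (identityˡ-unique)

  π* : List I → W × Bool → W × Bool
  π* [] z = z
  π* (k ∷ ws) z = π (gen k) (π* ws z)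

  ρ-eval : ∀ ws z → to (ρ (eval G ws)) z ≡ π* ws z
  ρ-eval [] z = ρ-e z
  ρ-eval (k ∷ ws) z = trans (ρ-∙ (gen k) (eval G ws) z) (trans (ρ-gen k _) (cong (π (gen k)) (ρ-eval ws z)))

  π*-cong : ∀ ws ws′ → eval G ws ≡ eval G ws′ → ∀ z → π* ws z ≡ π* ws′ z
  π*-cong ws ws′ eq z = trans (sym (ρ-eval ws z)) (trans (cong (λ w → to (ρ w) z) eq) (ρ-eval ws′ z))

  proj₁-π* : ∀ ws t b → proj₁ (π* ws (t , b)) ≡ conj (eval G ws) t
  proj₁-π* [] t b = sym (conj-e t)
  proj₁-π* (k ∷ ws) t b = trans (cong (conj (gen k)) (proj₁-π* ws t b)) (conj-∙ (gen k) (eval G ws) t)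

  inversion? : List I → W → Bool
  inversion? ws t = proj₂ (π* ws (t , false))

  reflections : List I → List W
  reflections [] = []
  reflections (k ∷ ws) = conj (eval G ws ⁻¹) (gen k) ∷ reflections ws

  odd? : W → List W → Bool
  odd? t [] = false
  odd? t (r ∷ rs) = odd? t rs xor does (t ≟ r)

  inversion?≡odd? : ∀ ws t → inversion? ws t ≡ odd? t (reflections ws)
  inversion?≡odd? [] t = refl
  inversion?≡odd? (k ∷ ws) t = cong₂ _xor_ (inversion?≡odd? ws t)
    (trans (cong (λ y → does (y ≟ gen k)) (proj₁-π* ws t false)) (does-conj (eval G ws) t (gen k) refl))

  odd?-∉ : ∀ t rs → t ∉ rs → odd? t rs ≡ false
  odd?-∉ t [] _ = refl
  odd?-∉ t (r ∷ rs) t∉ = cong₂ _xor_ (odd?-∉ t rs (t∉ ∘ there)) (dec-false (t ≟ r) (t∉ ∘ here))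

  odd?-∈ : ∀ t rs → Unique rs → t ∈ rs → odd? t rs ≡ true
  odd?-∈ t (r ∷ rs) (r∉ ∷ _) (here refl) = cong₂ _xor_ (odd?-∉ t rs (All¬⇒¬Any r∉)) (dec-true (t ≟ t) refl)
  odd?-∈ t (r ∷ rs) (r∉ ∷ unique) (there t∈) =
    cong₂ _xor_ (odd?-∈ t rs unique t∈) (dec-false (t ≟ r) λ { refl → All.lookup r∉ t∈ refl })

  inversion?-gen : ∀ ws i → eval G ws ≡ gen i → ∀ t → inversion? ws t ≡ does (t ≟ gen i)
  inversion?-gen ws i eq t = cong proj₂ (π*-cong ws (i ∷ []) (trans eq (sym (identityʳ (gen i)))) (t , false))

  gen≢e : ∀ i → gen i ≢ e
  gen≢e i eq with trans (inversion?-gen [] i (sym eq) (gen i)) (dec-true (gen i ≟ gen i) refl)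
  ... | ()

  eval-++ : ∀ xs ys → eval G (xs ++ ys) ≡ eval G xs ∙ eval G ys
  eval-++ [] ys = sym (identityˡ _)
  eval-++ (k ∷ xs) ys = trans (cong (gen k ∙_) (eval-++ xs ys)) (sym (assoc _ _ _))

  ∙-conj⁻¹ : ∀ x a → x ∙ conj (x ⁻¹) a ≡ a ∙ x
  ∙-conj⁻¹ x a = begin
      x ∙ (((x ⁻¹) ∙ a) ∙ ((x ⁻¹) ⁻¹)) ≡⟨ cong (λ y → x ∙ (((x ⁻¹) ∙ a) ∙ y)) (⁻¹-involutive x) ⟩
      x ∙ (((x ⁻¹) ∙ a) ∙ x)          ≡⟨ solve 4 (λ x x⁻ a x′ → x ⊛ ((x⁻ ⊛ a) ⊛ x′) ⊜ ((x ⊛ x⁻) ⊛ a) ⊛ x′) refl x (x ⁻¹) a x ⟩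
      ((x ∙ (x ⁻¹)) ∙ a) ∙ x          ≡⟨ cong (λ y → (y ∙ a) ∙ x) (inverseʳ x) ⟩
      (e ∙ a) ∙ x                     ≡⟨ cong (_∙ x) (identityˡ a) ⟩
      a ∙ x                           ∎
    where open ≡-Reasoning

  reflections-split : ∀ ws r → r ∈ reflections ws →
                      ∃ λ xs → ∃ λ b → ∃ λ ys → ws ≡ xs ++ b ∷ ys × r ≡ conj (eval G ys ⁻¹) (gen b)
  reflections-split (k ∷ ws) r (here r≡) = [] , k , ws , refl , r≡
  reflections-split (k ∷ ws) r (there r∈) with reflections-split ws r r∈
  ... | xs , b , ys , ws≡ , r≡ = k ∷ xs , b , ys , cong (k ∷_) ws≡ , r≡

  deletion : ∀ k xs b ys → conj (eval G (xs ++ b ∷ ys) ⁻¹) (gen k) ≡ conj (eval G ys ⁻¹) (gen b) →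
             gen k ∙ eval G (xs ++ b ∷ ys) ≡ eval G (xs ++ ys)
  deletion k xs b ys same-reflection = begin
      gen k ∙ E                          ≡⟨ sym (∙-conj⁻¹ E (gen k)) ⟩
      E ∙ conj (E ⁻¹) (gen k)            ≡⟨ cong (E ∙_) same-reflection ⟩
      E ∙ conj (Y ⁻¹) B                  ≡⟨ cong (_∙ conj (Y ⁻¹) B) (eval-++ xs (b ∷ ys)) ⟩
      (X ∙ (B ∙ Y)) ∙ conj (Y ⁻¹) B
        ≡⟨ solve 4 (λ X B Y R → (X ⊛ (B ⊛ Y)) ⊛ R ⊜ (X ⊛ B) ⊛ (Y ⊛ R)) refl X B Y (conj (Y ⁻¹) B) ⟩
      (X ∙ B) ∙ (Y ∙ conj (Y ⁻¹) B)      ≡⟨ cong ((X ∙ B) ∙_) (∙-conj⁻¹ Y B) ⟩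
      (X ∙ B) ∙ (B ∙ Y)                  ≡⟨ solve 3 (λ X B Y → (X ⊛ B) ⊛ (B ⊛ Y) ⊜ X ⊛ ((B ⊛ B) ⊛ Y)) refl X B Y ⟩
      X ∙ ((B ∙ B) ∙ Y)                  ≡⟨ cong (λ y → X ∙ (y ∙ Y)) (gen²≡e b) ⟩
      X ∙ (e ∙ Y)                        ≡⟨ cong (X ∙_) (identityˡ Y) ⟩
      X ∙ Y                              ≡⟨ sym (eval-++ xs ys) ⟩
      eval G (xs ++ ys)                  ∎
    where
    open ≡-Reasoning
    E X Y B : W
    E = eval G (xs ++ b ∷ ys)
    X = eval G xs
    Y = eval G ys
    B = gen b

  length-deletion : ∀ (xs : List I) b ys → length (xs ++ b ∷ ys) ≡ suc (length (xs ++ ys))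
  length-deletion [] b ys = refl
  length-deletion (x ∷ xs) b ys = cong suc (length-deletion xs b ys)

  open import Data.List.Membership.DecPropositional _≟_ using (_∈?_)

  shorten-or-unique : ∀ ws → (∃ λ vs → eval G vs ≡ eval G ws × 2 ℕ.+ length vs ≡ length ws) ⊎ Unique (reflections ws)
  shorten-or-unique [] = inj₂ []
  shorten-or-unique (k ∷ ws) with shorten-or-unique ws
  ... | inj₁ (vs , vs≡ , shorter) = inj₁ (k ∷ vs , cong (gen k ∙_) vs≡ , cong suc shorter)
  ... | inj₂ unique with conj (eval G ws ⁻¹) (gen k) ∈? reflections ws
  ...   | no r∉ = inj₂ (¬Any⇒All¬ _ r∉ ∷ unique)
  ...   | yes r∈ with reflections-split ws _ r∈
  ...     | xs , b , ys , refl , r≡ =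
    inj₁ (xs ++ ys , sym (deletion k xs b ys r≡) , cong suc (sym (length-deletion xs b ys)))

  word-with-unique-reflections : ∀ x → ∃ λ ws → eval G ws ≡ x × Unique (reflections ws)
  word-with-unique-reflections x = shortest (suc (length ws₀)) ws₀ (ℕP.n<1+n _) eval≡x
    where
    ws₀ : List I
    ws₀ = proj₁ (generates x)
    eval≡x : eval G ws₀ ≡ x
    eval≡x = proj₂ (generates x)
    shortest : ∀ n ws → length ws ℕ.< n → eval G ws ≡ x → ∃ λ ws → eval G ws ≡ x × Unique (reflections ws)
    shortest (suc n) ws (ℕ.s≤s |ws|≤n) ws≡x with shorten-or-unique ws
    ... | inj₂ unique = ws , ws≡x , unique
    ... | inj₁ (vs , vs≡ , shorter) =
      shortest n vs (ℕP.≤-trans (ℕP.n≤1+n _) (subst (ℕ._≤ n) (sym shorter) |ws|≤n)) (trans vs≡ ws≡x)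

  reflections-of-gen : ∀ ws i → eval G ws ≡ gen i → Unique (reflections ws) → ∀ {r} → r ∈ reflections ws → r ≡ gen i
  reflections-of-gen ws i ws≡gen unique {r} r∈ = does-true (r ≟ gen i)
    (trans (sym (inversion?-gen ws i ws≡gen r)) (trans (inversion?≡odd? ws r) (odd?-∈ r _ unique r∈)))
    where
    does-true : ∀ {A : Set} (a? : Dec A) → does a? ≡ true → A
    does-true (yes a) _ = a

  gen? : ∀ x → Dec (∃ λ i → gen i ≡ x)
  gen? x with word-with-unique-reflections x
  ... | [] , e≡x , _ = no λ (i , gi≡x) → gen≢e i (trans gi≡x (sym e≡x))
  ... | k ∷ [] , gk≡x , _ = yes (k , trans (sym (identityʳ (gen k))) gk≡x)
  ... | k ∷ k′ ∷ ws , ws≡x , unique@(r₁∉ ∷ _) = no λ (i , gi≡x) →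
    let r≡gen = reflections-of-gen (k ∷ k′ ∷ ws) i (trans ws≡x (sym gi≡x)) unique
    in All.head r₁∉ (trans (r≡gen (here refl)) (sym (r≡gen (there (here refl)))))

  Adj? : ∀ w w′ → Dec (∃ λ i → w′ ≡ gen i ∙ w)
  Adj? w w′ = map′ (λ (i , gi≡) → i , sym (trans (cong (_∙ w) gi≡) (//-rightDividesˡ w w′)))
                   (λ (i , w′≡) → i , sym (trans (cong (_∙ (w ⁻¹)) w′≡) (//-rightDividesʳ w (gen i))))
                   (gen? (w′ ∙ (w ⁻¹)))

-- The product Coxeter system

lefts : ∀ {A B : Set} → List (A ⊎ B) → List A
lefts [] = []
lefts (inj₁ a ∷ zs) = a ∷ lefts zs
lefts (inj₂ b ∷ zs) = lefts zs

rights : ∀ {A B : Set} → List (A ⊎ B) → List B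
rights [] = []
rights (inj₁ a ∷ zs) = rights zs
rights (inj₂ b ∷ zs) = b ∷ rights zs

inj-++ : ∀ {A B : Set} → List A → List B → List (A ⊎ B)
inj-++ as bs = map inj₁ as ++ map inj₂ bs

lefts-inj-++ : ∀ {A B : Set} (as : List A) (bs : List B) → lefts (inj-++ as bs) ≡ as
lefts-inj-++ (a ∷ as) bs = cong (a ∷_) (lefts-inj-++ as bs)
lefts-inj-++ [] [] = refl
lefts-inj-++ [] (b ∷ bs) = lefts-inj-++ [] bs

rights-inj-++ : ∀ {A B : Set} (as : List A) (bs : List B) → rights (inj-++ as bs) ≡ bs
rights-inj-++ (a ∷ as) bs = rights-inj-++ as bs
rights-inj-++ [] [] = refl
rights-inj-++ [] (b ∷ bs) = cong (b ∷_) (rights-inj-++ [] bs)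

length-lefts-rights : ∀ {A B : Set} (zs : List (A ⊎ B)) → length zs ≡ length (lefts zs) ℕ.+ length (rights zs)
length-lefts-rights [] = refl
length-lefts-rights (inj₁ a ∷ zs) = cong suc (length-lefts-rights zs)
length-lefts-rights (inj₂ b ∷ zs) = trans (cong suc (length-lefts-rights zs)) (sym (ℕP.+-suc _ _))

length-inj-++ : ∀ {A B : Set} (as : List A) (bs : List B) → length (inj-++ as bs) ≡ length as ℕ.+ length bs
length-inj-++ as bs = trans (length-lefts-rights (inj-++ as bs))
  (cong₂ ℕ._+_ (cong length (lefts-inj-++ as bs)) (cong length (rights-inj-++ as bs)))

module _ (H : Group 0ℓ 0ℓ) where
  open Group H using (Carrier; _≈_; _∙_; ε; assoc; identityˡ; identityʳ; ∙-congˡ; ∙-congʳ)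
    renaming (sym to ≈-sym; trans to ≈-trans; reflexive to ≈-reflexive)
  open import Relation.Binary.Reasoning.Setoid (Group.setoid H)

  Commute : Carrier → Carrier → Set
  Commute a c = a ∙ c ≈ c ∙ a

  Commute-∙ : ∀ {a b c} → Commute a c → Commute b c → Commute (a ∙ b) c
  Commute-∙ {a} {b} {c} ac bc = begin
    (a ∙ b) ∙ c ≈⟨ assoc a b c ⟩
    a ∙ (b ∙ c) ≈⟨ ∙-congˡ bc ⟩
    a ∙ (c ∙ b) ≈⟨ ≈-sym (assoc a c b) ⟩
    (a ∙ c) ∙ b ≈⟨ ∙-congʳ ac ⟩
    (c ∙ a) ∙ b ≈⟨ assoc c a b ⟩
    c ∙ (a ∙ b) ∎

  Commute-respˡ : ∀ {a b c} → a ≈ b → Commute b c → Commute a c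
  Commute-respˡ a≈b bc = ≈-trans (∙-congʳ a≈b) (≈-trans bc (∙-congˡ (≈-sym a≈b)))

  module _ (K : GenGroup) (generates : ∀ w → ∃ λ ws → eval K ws ≡ w)
           (ψ : GenGroup.W K → Carrier) (ψ-∙ : ∀ x y → ψ (GenGroup._∙_ K x y) ≈ ψ x ∙ ψ y)
           (ψ-e : ψ (GenGroup.e K) ≈ ε) where

    Commute-hom : ∀ {c} → (∀ i → Commute (ψ (GenGroup.gen K i)) c) → ∀ x → Commute (ψ x) c
    Commute-hom {c} gen-commutes x = subst (λ x → Commute (ψ x) c) (proj₂ (generates x)) (on-words (proj₁ (generates x)))
      where
      on-words : ∀ ws → Commute (ψ (eval K ws)) c
      on-words [] = Commute-respˡ ψ-e (≈-trans (identityˡ c) (≈-sym (identityʳ c)))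
      on-words (k ∷ ws) = Commute-respˡ (ψ-∙ _ _) (Commute-∙ (gen-commutes k) (on-words ws))

  hom-ε : ∀ {A : Set} (_·_ : A → A → A) {o : A} → o · o ≡ o →
          (ψ : A → Carrier) → (∀ x y → ψ (x · y) ≈ ψ x ∙ ψ y) → ψ o ≈ ε
  hom-ε _·_ {o} oo≡o ψ ψ-∙ = identityˡ-unique (ψ o) (ψ o) (≈-trans (≈-sym (ψ-∙ o o)) (≈-reflexive (cong ψ oo≡o)))
    where open import Algebra.Properties.Group H using (identityˡ-unique)

Len-unique : ∀ {K : GenGroup} {w m n} → Len K w m → Len K w n → m ≡ n
Len-unique ((ws , |ws|≡m , ws≡w) , m-min) ((vs , |vs|≡n , vs≡w) , n-min) =
  ℕP.≤-antisym (subst (_ ℕ.≤_) |vs|≡n (m-min vs vs≡w)) (subst (_ ℕ.≤_) |ws|≡m (n-min ws ws≡w))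

Len-exists : ∀ (K : GenGroup) {w} → (∃ λ ws → eval K ws ≡ w) → ¬ ¬ ∃ (Len K w)
Len-exists K {w} (ws₀ , ws₀≡w) ¬len = shortest (suc (length ws₀)) ws₀ (ℕP.n<1+n _) ws₀≡w
  where
  shortest : ∀ n ws → length ws ℕ.< n → eval K ws ≡ w → ⊥
  shortest (suc n) ws (ℕ.s≤s |ws|≤n) ws≡w = ¬len (length ws , (ws , refl , ws≡w) , minimal)
    where
    minimal : ∀ vs → eval K vs ≡ w → length ws ℕ.≤ length vs
    minimal vs vs≡w with length ws ℕ.≤? length vs
    ... | yes ≤ = ≤
    ... | no ≰ = ⊥-elim (shortest n vs (ℕP.<-≤-trans (ℕP.≰⇒> ≰) |ws|≤n) vs≡w)

module Product (G G′ : GenGroup) (C : IsFiniteCoxeterSystem G) (C′ : IsFiniteCoxeterSystem G′) where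
  open GenGroup G
  open GenGroup G′ using () renaming (W to W′; _∙_ to _∙′_; e to e′; _⁻¹ to _⁻¹′; I to I′; gen to gen′)
  module C = IsFiniteCoxeterSystem C
  module C′ = IsFiniteCoxeterSystem C′
  module W = IsGroup C.isGroup
  module W′ = IsGroup C′.isGroup
  module S = CoxeterSystem G C
  module S′ = CoxeterSystem G′ C′

  eval-⊗ : ∀ zs → eval (G ⊗ G′) zs ≡ (eval G (lefts zs) , eval G′ (rights zs))
  eval-⊗ [] = refl
  eval-⊗ (inj₁ i ∷ zs) = cong₂ _,_ (cong (gen i ∙_) (cong proj₁ (eval-⊗ zs)))
                                   (trans (cong (e′ ∙′_) (cong proj₂ (eval-⊗ zs))) (W′.identityˡ _))
  eval-⊗ (inj₂ i ∷ zs) = cong₂ _,_ (trans (cong (e ∙_) (cong proj₁ (eval-⊗ zs))) (W.identityˡ _))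
                                   (cong (gen′ i ∙′_) (cong proj₂ (eval-⊗ zs)))

  eval-inj-++ : ∀ ws ws′ → eval (G ⊗ G′) (inj-++ ws ws′) ≡ (eval G ws , eval G′ ws′)
  eval-inj-++ ws ws′ = trans (eval-⊗ (inj-++ ws ws′))
    (cong₂ (λ x y → eval G x , eval G′ y) (lefts-inj-++ ws ws′) (rights-inj-++ ws ws′))

  isGroup-⊗ : IsGroup _≡_ (GenGroup._∙_ (G ⊗ G′)) (GenGroup.e (G ⊗ G′)) (GenGroup._⁻¹ (G ⊗ G′))
  isGroup-⊗ = record
    { isMonoid = record
      { isSemigroup = record
        { isMagma = record { isEquivalence = isEquivalence ; ∙-cong = cong₂ (GenGroup._∙_ (G ⊗ G′)) }
        ; assoc = λ (x , x′) (y , y′) (z , z′) → cong₂ _,_ (W.assoc x y z) (W′.assoc x′ y′ z′) }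
      ; identity = (λ (x , x′) → cong₂ _,_ (W.identityˡ x) (W′.identityˡ x′))
                 , (λ (x , x′) → cong₂ _,_ (W.identityʳ x) (W′.identityʳ x′)) }
    ; inverse = (λ (x , x′) → cong₂ _,_ (W.inverseˡ x) (W′.inverseˡ x′))
              , (λ (x , x′) → cong₂ _,_ (W.inverseʳ x) (W′.inverseʳ x′))
    ; ⁻¹-cong = cong (GenGroup._⁻¹ (G ⊗ G′)) }
    where open import Relation.Binary.PropositionalEquality using (isEquivalence)

  m-⊗ : I ⊎ I′ → I ⊎ I′ → ℕ
  m-⊗ (inj₁ i) (inj₁ j) = C.m i j
  m-⊗ (inj₂ i) (inj₂ j) = C′.m i j
  m-⊗ (inj₁ i) (inj₂ j) = 2
  m-⊗ (inj₂ i) (inj₁ j) = 2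

  m-⊗-diag : ∀ a → m-⊗ a a ≡ 1
  m-⊗-diag (inj₁ i) = C.m-diag i
  m-⊗-diag (inj₂ i) = C′.m-diag i

  powW-⊗ : ∀ x x′ n → powW (G ⊗ G′) (x , x′) n ≡ (powW G x n , powW G′ x′ n)
  powW-⊗ x x′ zero = refl
  powW-⊗ x x′ (suc n) = cong (GenGroup._∙_ (G ⊗ G′) (x , x′)) (powW-⊗ x x′ n)

  relations-⊗ : ∀ a b → powW (G ⊗ G′) (GenGroup._∙_ (G ⊗ G′) (GenGroup.gen (G ⊗ G′) a) (GenGroup.gen (G ⊗ G′) b)) (m-⊗ a b)
                        ≡ GenGroup.e (G ⊗ G′)
  relations-⊗ (inj₁ i) (inj₁ j) =
    trans (powW-⊗ _ _ (C.m i j)) (cong₂ _,_ (C.relations i j) (S′.powW-≡e (C.m i j) (W′.identityˡ e′)))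
  relations-⊗ (inj₂ i) (inj₂ j) =
    trans (powW-⊗ _ _ (C′.m i j)) (cong₂ _,_ (S.powW-≡e (C′.m i j) (W.identityˡ e)) (C′.relations i j))
  relations-⊗ (inj₁ i) (inj₂ j) =
    trans (powW-⊗ _ _ 2) (cong₂ _,_ (S.powW-2-gen i (W.identityʳ _)) (S′.powW-2-gen j (W′.identityˡ _)))
  relations-⊗ (inj₂ i) (inj₁ j) =
    trans (powW-⊗ _ _ 2) (cong₂ _,_ (S.powW-2-gen j (W.identityˡ _)) (S′.powW-2-gen i (W′.identityʳ _)))

  gen-⊗-injective : ∀ {a b} → GenGroup.gen (G ⊗ G′) a ≡ GenGroup.gen (G ⊗ G′) b → a ≡ b
  gen-⊗-injective {inj₁ i} {inj₁ j} eq = cong inj₁ (C.gen-inj (cong proj₁ eq))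
  gen-⊗-injective {inj₁ i} {inj₂ j} eq = ⊥-elim (S.gen≢e i (cong proj₁ eq))
  gen-⊗-injective {inj₂ i} {inj₁ j} eq = ⊥-elim (S′.gen≢e i (cong proj₂ eq))
  gen-⊗-injective {inj₂ i} {inj₂ j} eq = cong inj₂ (C′.gen-inj (cong proj₂ eq))

  module Universal (H : Group 0ℓ 0ℓ) (f : I ⊎ I′ → Group.Carrier H)
                   (rel : ∀ a b → Group._≈_ H (powG H (Group._∙_ H (f a) (f b)) (m-⊗ a b)) (Group.ε H)) where
    open Group H using (_≈_; ε; ∙-cong; ∙-congˡ; ∙-congʳ; assoc; identityˡ; identityʳ)
      renaming (Carrier to A; _∙_ to _·_; _⁻¹ to _⁻¹ᴴ; sym to ≈-sym; trans to ≈-trans; reflexive to ≈-reflexive)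
    open import Algebra.Properties.Group H using (inverseˡ-unique; ⁻¹-anti-homo-∙)
    open import Relation.Binary.Reasoning.Setoid (Group.setoid H)

    Extension : (K : GenGroup) → (GenGroup.I K → A) → Set
    Extension K g = Σ (GenGroup.W K → A) λ φ →
      (∀ x y → φ (GenGroup._∙_ K x y) ≈ φ x · φ y) × (∀ i → φ (GenGroup.gen K i) ≈ g i)

    extension₁ : Extension G (f ∘ inj₁)
    extension₁ = C.universal H (f ∘ inj₁) (λ i j → rel (inj₁ i) (inj₁ j))

    extension₂ : Extension G′ (f ∘ inj₂)
    extension₂ = C′.universal H (f ∘ inj₂) (λ i j → rel (inj₂ i) (inj₂ j))

    φ₁ : W → A
    φ₁ = proj₁ extension₁
    φ₂ : W′ → A
    φ₂ = proj₁ extension₂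

    φ₁-e : φ₁ e ≈ ε
    φ₁-e = hom-ε H _∙_ (W.identityˡ e) φ₁ (proj₁ (proj₂ extension₁))
    φ₂-e : φ₂ e′ ≈ ε
    φ₂-e = hom-ε H _∙′_ (W′.identityˡ e′) φ₂ (proj₁ (proj₂ extension₂))

    f-self-inverse : ∀ a → f a ≈ f a ⁻¹ᴴ
    f-self-inverse a = inverseˡ-unique _ _
      (≈-trans (≈-sym (identityʳ _)) (subst (λ k → powG H (f a · f a) k ≈ ε) (m-⊗-diag a) (rel a a)))

    f-commute : ∀ i j → Commute H (f (inj₂ j)) (f (inj₁ i))
    f-commute i j = begin
      b · a           ≈⟨ inverseˡ-unique (b · a) (b · a) (≈-trans (∙-congˡ (≈-sym (identityʳ _))) (rel (inj₂ j) (inj₁ i))) ⟩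
      (b · a) ⁻¹ᴴ     ≈⟨ ⁻¹-anti-homo-∙ b a ⟩
      a ⁻¹ᴴ · b ⁻¹ᴴ   ≈⟨ ∙-cong (≈-sym (f-self-inverse (inj₁ i))) (≈-sym (f-self-inverse (inj₂ j))) ⟩
      a · b           ∎
      where
      a b : A
      a = f (inj₁ i)
      b = f (inj₂ j)

    φ₁-φ₂-commute : ∀ x y → Commute H (φ₁ x) (φ₂ y)
    φ₁-φ₂-commute x y = Commute-hom H G C.generates φ₁ (proj₁ (proj₂ extension₁)) φ₁-e
      (λ i → Commute-respˡ H (proj₂ (proj₂ extension₁) i) (≈-sym (φ₂-commutes-gen i y))) x
      where
      φ₂-commutes-gen : ∀ i y → Commute H (φ₂ y) (f (inj₁ i))
      φ₂-commutes-gen i = Commute-hom H G′ C′.generates φ₂ (proj₁ (proj₂ extension₂)) φ₂-e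
        (λ j → Commute-respˡ H (proj₂ (proj₂ extension₂) j) (f-commute i j))

    φ : W × W′ → A
    φ (x , x′) = φ₁ x · φ₂ x′

    φ-∙ : ∀ p q → φ (GenGroup._∙_ (G ⊗ G′) p q) ≈ φ p · φ q
    φ-∙ (x , x′) (y , y′) = begin
      φ₁ (x ∙ y) · φ₂ (x′ ∙′ y′)        ≈⟨ ∙-cong (proj₁ (proj₂ extension₁) x y) (proj₁ (proj₂ extension₂) x′ y′) ⟩
      (φ₁ x · φ₁ y) · (φ₂ x′ · φ₂ y′)   ≈⟨ assoc _ _ _ ⟩
      φ₁ x · (φ₁ y · (φ₂ x′ · φ₂ y′))   ≈⟨ ∙-congˡ (≈-sym (assoc _ _ _)) ⟩
      φ₁ x · ((φ₁ y · φ₂ x′) · φ₂ y′)   ≈⟨ ∙-congˡ (∙-congʳ (φ₁-φ₂-commute y x′)) ⟩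
      φ₁ x · ((φ₂ x′ · φ₁ y) · φ₂ y′)   ≈⟨ ∙-congˡ (assoc _ _ _) ⟩
      φ₁ x · (φ₂ x′ · (φ₁ y · φ₂ y′))   ≈⟨ ≈-sym (assoc _ _ _) ⟩
      (φ₁ x · φ₂ x′) · (φ₁ y · φ₂ y′)   ∎

    φ-gen : ∀ a → φ (GenGroup.gen (G ⊗ G′) a) ≈ f a
    φ-gen (inj₁ i) = ≈-trans (∙-cong (proj₂ (proj₂ extension₁) i) φ₂-e) (identityʳ _)
    φ-gen (inj₂ i) = ≈-trans (∙-cong φ₁-e (proj₂ (proj₂ extension₂) i)) (identityˡ _)

  isFiniteCoxeterSystem-⊗ : IsFiniteCoxeterSystem (G ⊗ G′)
  isFiniteCoxeterSystem-⊗ = record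
    { isGroup = isGroup-⊗
    ; finite = _ , Enumeration-× (proj₂ C.finite) (proj₂ C′.finite)
    ; gen-inj = gen-⊗-injective
    ; m = m-⊗
    ; m-diag = m-⊗-diag
    ; m-sym = λ { (inj₁ i) (inj₁ j) → C.m-sym i j ; (inj₂ i) (inj₂ j) → C′.m-sym i j
                ; (inj₁ i) (inj₂ j) → refl ; (inj₂ i) (inj₁ j) → refl }
    ; m-off = λ { (inj₁ i) (inj₁ j) i≢j → C.m-off i j (i≢j ∘ cong inj₁) ; (inj₂ i) (inj₂ j) i≢j → C′.m-off i j (i≢j ∘ cong inj₂)
                ; (inj₁ i) (inj₂ j) _ → ℕP.≤-refl ; (inj₂ i) (inj₁ j) _ → ℕP.≤-refl }
    ; relations = relations-⊗
    ; generates = λ (x , x′) → let (ws , ws≡x) = C.generates x ; (ws′ , ws′≡x′) = C′.generates x′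
                              in inj-++ ws ws′ , trans (eval-inj-++ ws ws′) (cong₂ _,_ ws≡x ws′≡x′)
    ; universal = λ H f rel → Universal.φ H f rel , Universal.φ-∙ H f rel , Universal.φ-gen H f rel
    }

  Len-⊗ : ∀ {w w′ n n′} → Len G w n → Len G′ w′ n′ → Len (G ⊗ G′) (w , w′) (n ℕ.+ n′)
  Len-⊗ ((ws , |ws|≡n , ws≡w) , n-min) ((ws′ , |ws′|≡n′ , ws′≡w′) , n′-min) =
    (inj-++ ws ws′ , trans (length-inj-++ ws ws′) (cong₂ ℕ._+_ |ws|≡n |ws′|≡n′) ,
                          trans (eval-inj-++ ws ws′) (cong₂ _,_ ws≡w ws′≡w′)) ,
    λ zs zs≡ → subst (_ ℕ.≤_) (sym (length-lefts-rights zs))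
      (ℕP.+-mono-≤ (n-min (lefts zs) (cong proj₁ (trans (sym (eval-⊗ zs)) zs≡)))
                   (n′-min (rights zs) (cong proj₂ (trans (sym (eval-⊗ zs)) zs≡))))

  Len-⊗-split : ∀ {w w′ n} → Len (G ⊗ G′) (w , w′) n → ∃ λ n₁ → ∃ λ n₂ → Len G w n₁ × Len G′ w′ n₂ × n ≡ n₁ ℕ.+ n₂
  Len-⊗-split {w} {w′} {n} ((zs , |zs|≡n , zs≡) , n-min) =
    n₁ , n₂ , ((lefts zs , refl , cong proj₁ split≡) , n₁-min) , ((rights zs , refl , cong proj₂ split≡) , n₂-min) , n≡
    where
    n₁ n₂ : ℕ
    n₁ = length (lefts zs)
    n₂ = length (rights zs)
    split≡ : (eval G (lefts zs) , eval G′ (rights zs)) ≡ (w , w′)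
    split≡ = trans (sym (eval-⊗ zs)) zs≡
    n≡ : n ≡ n₁ ℕ.+ n₂
    n≡ = trans (sym |zs|≡n) (length-lefts-rights zs)
    n₁-min : ∀ ws → eval G ws ≡ w → n₁ ℕ.≤ length ws
    n₁-min ws ws≡w = ℕP.+-cancelʳ-≤ n₂ n₁ (length ws) (subst₂ ℕ._≤_ n≡ (length-inj-++ ws (rights zs))
      (n-min (inj-++ ws (rights zs)) (trans (eval-inj-++ ws (rights zs)) (cong₂ _,_ ws≡w (cong proj₂ split≡)))))
    n₂-min : ∀ ws → eval G′ ws ≡ w′ → n₂ ℕ.≤ length ws
    n₂-min ws ws≡w′ = ℕP.+-cancelˡ-≤ n₁ n₂ (length ws) (subst₂ ℕ._≤_ n≡ (length-inj-++ (lefts zs) ws)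
      (n-min (inj-++ (lefts zs) ws) (trans (eval-inj-++ (lefts zs) ws) (cong₂ _,_ (cong proj₁ split≡) ws≡w′))))

  module _ (J : I → Set) (J′ : I′ → Set) where

    InWJmin-⊗ : ∀ {w w′} → InWJmin G J w → InWJmin G′ J′ w′ → InWJmin (G ⊗ G′) (J ⊕ J′) (w , w′)
    InWJmin-⊗ {w} {w′} w-min _ (inj₁ j) j∈J n m len len-j with Len-⊗-split len | Len-⊗-split len-j
    ... | n₁ , n₂ , L₁ , L₂ , refl | m₁ , m₂ , M₁ , M₂ , refl =
      subst (λ k → n₁ ℕ.+ n₂ ℕ.< m₁ ℕ.+ k) (Len-unique L₂ (subst (λ v → Len G′ v m₂) (W′.identityʳ w′) M₂))
        (ℕP.+-monoˡ-< n₂ (w-min j j∈J n₁ m₁ L₁ M₁))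
    InWJmin-⊗ {w} {w′} _ w′-min (inj₂ j) j∈J′ n m len len-j with Len-⊗-split len | Len-⊗-split len-j
    ... | n₁ , n₂ , L₁ , L₂ , refl | m₁ , m₂ , M₁ , M₂ , refl =
      subst (λ k → n₁ ℕ.+ n₂ ℕ.< k ℕ.+ m₂) (Len-unique L₁ (subst (λ v → Len G v m₁) (W.identityʳ w) M₁))
        (ℕP.+-monoʳ-< n₁ (w′-min j j∈J′ n₂ m₂ L₂ M₂))

    InWJmin-⊗⁻¹ : ∀ {w w′} → InWJmin (G ⊗ G′) (J ⊕ J′) (w , w′) → InWJmin G J w × InWJmin G′ J′ w′
    InWJmin-⊗⁻¹ {w} {w′} ww′-min = left , right
      where
      left : InWJmin G J w
      left j j∈J n₁ m₁ L₁ M₁ with n₁ ℕ.<? m₁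
      ... | yes < = <
      ... | no ≮ = ⊥-elim (Len-exists G′ (C′.generates w′) λ (n₂ , L₂) →
        ≮ (ℕP.+-cancelʳ-< n₂ n₁ m₁ (ww′-min (inj₁ j) j∈J (n₁ ℕ.+ n₂) (m₁ ℕ.+ n₂) (Len-⊗ L₁ L₂)
             (Len-⊗ M₁ (subst (λ v → Len G′ v n₂) (sym (W′.identityʳ w′)) L₂)))))
      right : InWJmin G′ J′ w′
      right j j∈J′ n₂ m₂ L₂ M₂ with n₂ ℕ.<? m₂
      ... | yes < = <
      ... | no ≮ = ⊥-elim (Len-exists G (C.generates w) λ (n₁ , L₁) →
        ≮ (ℕP.+-cancelˡ-< n₁ n₂ m₂ (ww′-min (inj₂ j) j∈J′ (n₁ ℕ.+ n₂) (n₁ ℕ.+ m₂) (Len-⊗ L₁ L₂)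
             (Len-⊗ (subst (λ v → Len G v n₁) (sym (W.identityʳ w)) L₁) M₂))))

    InWJ-⊗ : ∀ {z} → InWJ (G ⊗ G′) (J ⊕ J′) z → InWJ G J (proj₁ z) × InWJ G′ J′ (proj₂ z)
    InWJ-⊗ wj-e = wj-e , wj-e
    InWJ-⊗ (wj-gen (inj₁ j) j∈J) = wj-gen j j∈J , wj-e
    InWJ-⊗ (wj-gen (inj₂ j) j∈J′) = wj-e , wj-gen j j∈J′
    InWJ-⊗ (wj-mul x y) = wj-mul (proj₁ (InWJ-⊗ x)) (proj₁ (InWJ-⊗ y)) , wj-mul (proj₂ (InWJ-⊗ x)) (proj₂ (InWJ-⊗ y))
    InWJ-⊗ (wj-inv x) = wj-inv (proj₁ (InWJ-⊗ x)) , wj-inv (proj₂ (InWJ-⊗ x))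

    WJAbelian-⊗ : WJAbelian G J → WJAbelian G′ J′ → WJAbelian (G ⊗ G′) (J ⊕ J′)
    WJAbelian-⊗ abelian abelian′ x y x∈ y∈ =
      cong₂ _,_ (abelian _ _ (proj₁ (InWJ-⊗ x∈)) (proj₁ (InWJ-⊗ y∈))) (abelian′ _ _ (proj₂ (InWJ-⊗ x∈)) (proj₂ (InWJ-⊗ y∈)))

    GW-⊗-Vert⇔ : ∀ p → Graph.Vert (GW G J □ GW G′ J′) p ⇔ Graph.Vert (GW (G ⊗ G′) (J ⊕ J′)) p
    GW-⊗-Vert⇔ (w , w′) = mk⇔ (λ (w-min , w′-min) → InWJmin-⊗ w-min w′-min) InWJmin-⊗⁻¹

    GW-⊗-Adj⇔ : ∀ p q → Graph.Adj (GW G J □ GW G′ J′) p q ⇔ Graph.Adj (GW (G ⊗ G′) (J ⊕ J′)) p q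
    GW-⊗-Adj⇔ (u , u′) (v , v′) = mk⇔ to from
      where
      to : Graph.Adj (GW G J □ GW G′ J′) (u , u′) (v , v′) → Graph.Adj (GW (G ⊗ G′) (J ⊕ J′)) (u , u′) (v , v′)
      to (inj₁ (refl , i , v′≡)) = inj₂ i , cong₂ _,_ (sym (W.identityˡ u)) v′≡
      to (inj₂ (refl , i , v≡)) = inj₁ i , cong₂ _,_ v≡ (sym (W′.identityˡ u′))
      from : Graph.Adj (GW (G ⊗ G′) (J ⊕ J′)) (u , u′) (v , v′) → Graph.Adj (GW G J □ GW G′ J′) (u , u′) (v , v′)
      from (inj₁ i , vv′≡) = inj₂ (trans (sym (W′.identityˡ u′)) (sym (cong proj₂ vv′≡)) , i , cong proj₁ vv′≡)
      from (inj₂ i , vv′≡) = inj₁ (trans (sym (W.identityˡ u)) (sym (cong proj₁ vv′≡)) , i , cong proj₂ vv′≡)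

    Iota0-GW-⊗ : ∀ {k} → Iota0 (GW G J □ GW G′ J′) k → Iota0 (GW (G ⊗ G′) (J ⊕ J′)) k
    Iota0-GW-⊗ = Iota0-⇔ GW-⊗-Vert⇔ GW-⊗-Adj⇔

*-pos : ∀ {a b} → + 0 < a → + 0 < b → + 0 < a * b
*-pos (+<+ (s≤s _)) (+<+ (s≤s _)) = +<+ (s≤s z≤n)

proposition6p3 : (G G′ : GenGroup) (J : GenGroup.I G → Set) (J′ : GenGroup.I G′ → Set) →
    IsFiniteCoxeterSystem G → CubeLikeWrt G J →
    IsFiniteCoxeterSystem G′ → CubeLikeWrt G′ J′ →
    (IsFiniteCoxeterSystem (G ⊗ G′) × CubeLikeWrt (G ⊗ G′) (J ⊕ J′))
    × (∀ a b → Iota0 (GW G J) a → Iota0 (GW G′ J′) b →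
    ∃ λ c → Iota0 (GW G J □ GW G′ J′) c × a * b ≤ c)
proposition6p3 G G′ J J′ C cube-like C′ cube-like′ = (isFiniteCoxeterSystem-⊗ , cube-like-⊗ cube-like cube-like′) , box-bound
  where
  open Product G G′ C C′
  box-bound : ∀ a b → Iota0 (GW G J) a → Iota0 (GW G′ J′) b → ∃ λ c → Iota0 (GW G J □ GW G′ J′) c × a * b ≤ c
  box-bound a b (achieves , _) (achieves′ , _) =
    Iota0-□-≥ (GW G J) (GW G′ J′) (proj₂ C.finite) (proj₂ C′.finite) S.Adj? S′.Adj? achieves achieves′
  cube-like-⊗ : CubeLikeWrt G J → CubeLikeWrt G′ J′ → CubeLikeWrt (G ⊗ G′) (J ⊕ J′)
  cube-like-⊗ (abelian , a , ι-a , 0<a) (abelian′ , b , ι-b , 0<b) with box-bound a b ι-a ι-b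
  ... | c , ι-c , ab≤c =
    WJAbelian-⊗ J J′ abelian abelian′ , c , Iota0-GW-⊗ J J′ ι-c , ℤP.<-≤-trans (*-pos 0<a 0<b) ab≤c
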